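{- Let $\lambda\neq0$. For integers $n\ge0$ and $m\in\mathbb{N}$ with $m\equiv1\pmod2$, \[ 2^{n-1}\bigl(E_{n,\lambda}(m)+E_{n,\lambda}\bigr)=\sum_{l=0}^{m-1}(-1)^l(2l+1)_{n,2\lambda}. \]
   Context: $(x)_{0,\lambda}=1$, $(x)_{k,\lambda}=x(x-\lambda)\cdots(x-(k-1)\lambda)$ for $k\ge1$; $e_\lambda^x(t)=(1+\lambda t)^{x/\lambda}=\sum_{k\ge0}(x)_{k,\lambda}\frac{t^k}{k!}$. Degenerate type 2 Euler polynomials: $\frac{2}{e_\lambda^{1/2}(t)+e_\lambda^{ -1/2}(t)}e_\lambda^x(t)=\sum_{n\ge0}E_{n,\lambda}(x)\frac{t^n}{n!}$ (formal power series in $t$), and $E_{n,\lambda}=E_{n,\lambda}(0)$. -}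

module Defs where

open import Algebra.Bundles using (CommutativeRing)
open import Data.Nat using (ℕ; zero; suc)
import Data.Nat as N
open import Data.Nat.Combinatorics using (_C_)
open import Data.Fin using (Fin; toℕ)
open import Data.Vec using (Vec; []; _∷_; head; lookup; tabulate; foldr′)

-- All definitions are relative to a commutative ring R together with an
-- element `half` (intended: 2 · half ≈ 1, i.e. a ring in which 2 is invertible,
-- e.g. ℝ or ℂ).
module Degenerate {c ℓ} (R : CommutativeRing c ℓ) (half : CommutativeRing.Carrier R) where
  open CommutativeRing R public

  fromℕ : ℕ → Carrier
  fromℕ zero    = 0#
  fromℕ (suc k) = 1# + fromℕ k

  two : Carrier
  two = 1# + 1#

  ff : Carrier → ℕ → Carrier → Carrier
  ff x zero    lam = 1#
  ff x (suc k) lam = ff x k lam * (x - fromℕ k * lam)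

  sumTo : ℕ → (ℕ → Carrier) → Carrier
  sumTo zero    f = 0#
  sumTo (suc n) f = sumTo n f + f n

  sumV : ∀ {n} → Vec Carrier n → Carrier
  sumV = foldr′ _+_ 0#

  sign : ℕ → Carrier
  sign zero    = 1#
  sign (suc l) = - sign l

  -- 2^(n-1), with 2^(-1) = half
  pow2m1 : ℕ → Carrier
  pow2m1 zero          = half
  pow2m1 (suc zero)    = 1#
  pow2m1 (suc (suc n)) = two * pow2m1 (suc n)

  -- EGF coefficients of e_lam^{1/2}(t) + e_lam^{-1/2}(t):
  --   a_k = (1/2)_{k,lam} + (-1/2)_{k,lam}
  aCoef : Carrier → ℕ → Carrier
  aCoef lam k = ff half k lam + ff (- half) k lam

  -- EGF coefficients g_n of 2 / (e_lam^{1/2}(t) + e_lam^{-1/2}(t)), determined by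
  --   sum_{k=0}^{n} C(n,k) a_k g_{n-k} = 2 δ_{n,0}   (a_0 = 2):
  --   g_0 = 1,  g_N = - half * sum_{k=1}^{N} C(N,k) a_k g_{N-k}.
  -- gs lam n = [g_n, g_{n-1}, ..., g_0]  (so lookup (gs lam n) i = g_{n-i}).
  gs : Carrier → (n : ℕ) → Vec Carrier (suc n)
  gs lam zero    = 1# ∷ []
  gs lam (suc n) =
    - (half * sumV (tabulate λ (i : Fin (suc n)) →
           fromℕ (suc n C suc (toℕ i)) * aCoef lam (suc (toℕ i)) * lookup (gs lam n) i))
    ∷ gs lam n

  g : Carrier → ℕ → Carrier
  g lam n = head (gs lam n)

  -- Degenerate type 2 Euler polynomial E_{n,lam}(x), i.e. the n-th EGF coefficient
  -- of (2 / (e^{1/2} + e^{-1/2})) · e_lam^x(t):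
  --   E_{n,lam}(x) = sum_{k=0}^{n} C(n,k) g_k (x)_{n-k,lam}
  E : ℕ → Carrier → Carrier → Carrier
  E n lam x = sumTo (suc n) λ k → fromℕ (n C k) * g lam k * ff x (n N.∸ k) lam

-- View sequences as coefficients of exponential generating functions, so that their
-- product is the binomial convolution ⊛, and write e^x for the sequence k ↦ (x)_{k,λ}
-- of e_λ^x(t).  Falling factorials satisfy Vandermonde's identity e^x ⊛ e^y = e^(x+y);
-- with a = e^(1/2) + e^(-1/2) and g = 2/a this gives g ⊛ a = 2 and
-- a ⊛ e^(l+1/2) = e^(l+1) + e^l.  Hence for odd m the alternating sum
-- S = Σ_{l<m} (-1)^l e^(l+1/2) satisfies a ⊛ S = e^m + e^0 by telescoping, and so
-- E(m) + E(0) = g ⊛ (e^m + e^0) = g ⊛ a ⊛ S = 2 S.  Finally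
-- 2^n (l + 1/2)_{n,λ} = (2l + 1)_{n,2λ}.
module Submission where

open import Algebra.Bundles using (CommutativeRing)
open import Algebra.Solver.Ring.AlmostCommutativeRing
  using (fromCommutativeRing; _-Raw-AlmostCommutative⟶_)
import Algebra.Solver.Ring as RingSolver
open import Data.Fin as Fin using (Fin; toℕ)
open import Data.Integer as ℤ using (ℤ; +_; -[1+_])
import Data.Integer.Properties as ℤ
open import Data.Maybe using (Maybe; just; nothing)
open import Data.Nat using (ℕ; zero; suc)
import Data.Nat as N
import Data.Nat.DivMod as N
import Data.Nat.Properties as N
open import Data.Nat.Combinatorics using (_C_; k>n⇒nCk≡0; nCk+nC[k+1]≡[n+1]C[k+1])
open import Data.Sign as Sign using (Sign)
open import Data.Vec using (lookup; tabulate)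
open import Relation.Binary.PropositionalEquality as P using (_≡_)
open import Relation.Nullary using (¬_; yes; no)

open import Defs

-- The ring solver for R needs a coefficient ring with decidable equality
-- mapping into R; ℤ is the canonical one.
module IntegerCoefficients {c ℓ} (R : CommutativeRing c ℓ) where
  open CommutativeRing R
  open import Algebra.Properties.Ring ring using (-‿distribˡ-*; -‿distribʳ-*)
  open import Algebra.Properties.AbelianGroup +-abelianGroup
    using (⁻¹-∙-comm; ⁻¹-involutive; ε⁻¹≈ε)
  open import Algebra.Properties.Semiring.Mult semiring using (_×_; ×-homo-+; ×1-homo-*)
  open import Relation.Binary.Reasoning.Setoid setoid

  ⟦_⟧ : ℤ → Carrier
  ⟦ + n ⟧      = n × 1#
  ⟦ -[1+ n ] ⟧ = - (suc n × 1#)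

  signed : Sign → Carrier → Carrier
  signed Sign.+ x = x
  signed Sign.- x = - x

  signed-cong : ∀ s {x y} → x ≈ y → signed s x ≈ signed s y
  signed-cong Sign.+ x≈y = x≈y
  signed-cong Sign.- x≈y = -‿cong x≈y

  signed-* : ∀ s t x y → signed (s Sign.* t) (x * y) ≈ signed s x * signed t y
  signed-* Sign.+ Sign.+ x y = refl
  signed-* Sign.+ Sign.- x y = -‿distribʳ-* x y
  signed-* Sign.- Sign.+ x y = -‿distribˡ-* x y
  signed-* Sign.- Sign.- x y = begin
    x * y           ≈⟨ ⁻¹-involutive _ ⟨
    - - (x * y)     ≈⟨ -‿cong (-‿distribʳ-* x y) ⟩
    - (x * - y)     ≈⟨ -‿distribˡ-* x (- y) ⟩
    - x * - y       ∎

  ⟦◃⟧ : ∀ s n → ⟦ s ℤ.◃ n ⟧ ≈ signed s (n × 1#)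
  ⟦◃⟧ Sign.+ zero    = refl
  ⟦◃⟧ Sign.- zero    = sym ε⁻¹≈ε
  ⟦◃⟧ Sign.+ (suc n) = refl
  ⟦◃⟧ Sign.- (suc n) = refl

  ⟦⟧-sign-abs : ∀ i → ⟦ i ⟧ ≈ signed (ℤ.sign i) (ℤ.∣ i ∣ × 1#)
  ⟦⟧-sign-abs (+ n)      = refl
  ⟦⟧-sign-abs -[1+ n ]   = refl

  ⟦⊖⟧ : ∀ m n → ⟦ m ℤ.⊖ n ⟧ ≈ m × 1# - n × 1#
  ⟦⊖⟧ m zero = begin
    ⟦ m ℤ.⊖ 0 ⟧       ≡⟨ P.cong ⟦_⟧ (ℤ.⊖-≥ {m} N.z≤n) ⟩
    m × 1#            ≈⟨ +-identityʳ _ ⟨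
    m × 1# + 0#       ≈⟨ +-congˡ ε⁻¹≈ε ⟨
    m × 1# - 0#       ∎
  ⟦⊖⟧ zero    (suc n) = sym (+-identityˡ _)
  ⟦⊖⟧ (suc m) (suc n) = begin
    ⟦ suc m ℤ.⊖ suc n ⟧                   ≡⟨ P.cong ⟦_⟧ (ℤ.[1+m]⊖[1+n]≡m⊖n m n) ⟩
    ⟦ m ℤ.⊖ n ⟧                           ≈⟨ ⟦⊖⟧ m n ⟩
    M + - N                               ≈⟨ +-identityˡ _ ⟨
    0# + (M + - N)                        ≈⟨ +-congʳ (-‿inverseʳ 1#) ⟨
    (1# + - 1#) + (M + - N)               ≈⟨ +-assoc _ _ _ ⟩
    1# + (- 1# + (M + - N))               ≈⟨ +-congˡ (+-assoc _ _ _) ⟨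
    1# + ((- 1# + M) + - N)               ≈⟨ +-congˡ (+-congʳ (+-comm _ _)) ⟩
    1# + ((M + - 1#) + - N)               ≈⟨ +-congˡ (+-assoc _ _ _) ⟩
    1# + (M + (- 1# + - N))               ≈⟨ +-assoc _ _ _ ⟨
    (1# + M) + (- 1# + - N)               ≈⟨ +-congˡ (⁻¹-∙-comm _ _) ⟩
    (1# + M) - (1# + N)                   ∎
    where M = m × 1#; N = n × 1#

  ⟦+⟧ : ∀ i j → ⟦ i ℤ.+ j ⟧ ≈ ⟦ i ⟧ + ⟦ j ⟧
  ⟦+⟧ (+ m)    (+ n)    = ×-homo-+ 1# m n
  ⟦+⟧ (+ m)    -[1+ n ] = ⟦⊖⟧ m (suc n)
  ⟦+⟧ -[1+ m ] (+ n)    = trans (⟦⊖⟧ n (suc m)) (+-comm _ _)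
  ⟦+⟧ -[1+ m ] -[1+ n ] = begin
    - (suc (suc (m N.+ n)) × 1#)          ≡⟨ P.cong (λ k → - (suc k × 1#)) (N.+-suc m n) ⟨
    - ((suc m N.+ suc n) × 1#)            ≈⟨ -‿cong (×-homo-+ 1# (suc m) (suc n)) ⟩
    - (suc m × 1# + suc n × 1#)           ≈⟨ ⁻¹-∙-comm _ _ ⟨
    - (suc m × 1#) + - (suc n × 1#)       ∎

  ⟦*⟧ : ∀ i j → ⟦ i ℤ.* j ⟧ ≈ ⟦ i ⟧ * ⟦ j ⟧
  ⟦*⟧ i j = begin
    ⟦ s ℤ.◃ (∣i∣ N.* ∣j∣) ⟧               ≈⟨ ⟦◃⟧ s (∣i∣ N.* ∣j∣) ⟩
    signed s ((∣i∣ N.* ∣j∣) × 1#)          ≈⟨ signed-cong s (×1-homo-* ∣i∣ ∣j∣) ⟩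
    signed s (∣i∣ × 1# * ∣j∣ × 1#)         ≈⟨ signed-* (ℤ.sign i) (ℤ.sign j) _ _ ⟩
    signed (ℤ.sign i) (∣i∣ × 1#) * signed (ℤ.sign j) (∣j∣ × 1#)
                                           ≈⟨ *-cong (⟦⟧-sign-abs i) (⟦⟧-sign-abs j) ⟨
    ⟦ i ⟧ * ⟦ j ⟧                          ∎
    where
    s = ℤ.sign i Sign.* ℤ.sign j
    ∣i∣ = ℤ.∣ i ∣
    ∣j∣ = ℤ.∣ j ∣

  ⟦-⟧ : ∀ i → ⟦ ℤ.- i ⟧ ≈ - ⟦ i ⟧
  ⟦-⟧ (+ zero)  = sym ε⁻¹≈ε
  ⟦-⟧ (+ suc n) = refl
  ⟦-⟧ -[1+ n ]  = sym (⁻¹-involutive _)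

  ℤ⟶R : ℤ.+-*-rawRing -Raw-AlmostCommutative⟶ fromCommutativeRing R
  ℤ⟶R = record
    { ⟦_⟧ = ⟦_⟧ ; +-homo = ⟦+⟧ ; *-homo = ⟦*⟧ ; -‿homo = ⟦-⟧
    ; 0-homo = refl ; 1-homo = +-identityʳ 1# }

  ⟦⟧-≟ : ∀ i j → Maybe (⟦ i ⟧ ≈ ⟦ j ⟧)
  ⟦⟧-≟ i j with i ℤ.≟ j
  ... | yes P.refl = just refl
  ... | no _       = nothing

  open RingSolver ℤ.+-*-rawRing (fromCommutativeRing R) ℤ⟶R ⟦⟧-≟ public
    using (solve; _:=_; _:+_; _:*_; _:-_; :-_; con)

module Lemmas {c ℓ} (R : CommutativeRing c ℓ) (half : CommutativeRing.Carrier R) where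
  open Degenerate R half hiding (zero)
  open IntegerCoefficients R using (solve; _:=_; _:+_; _:*_; _:-_; :-_; con)
  open import Algebra.Properties.AbelianGroup +-abelianGroup using (⁻¹-involutive)
  open import Algebra.Properties.Semiring.Exp semiring using (_^_)
  open import Relation.Binary.Reasoning.Setoid setoid

  fromℕ-+ : ∀ m n → fromℕ (m N.+ n) ≈ fromℕ m + fromℕ n
  fromℕ-+ zero    n = sym (+-identityˡ _)
  fromℕ-+ (suc m) n = trans (+-congˡ (fromℕ-+ m n)) (sym (+-assoc _ _ _))

  fromℕ-* : ∀ m n → fromℕ (m N.* n) ≈ fromℕ m * fromℕ n
  fromℕ-* zero    n = sym (zeroˡ _)
  fromℕ-* (suc m) n = begin
    fromℕ (n N.+ m N.* n)              ≈⟨ fromℕ-+ n (m N.* n) ⟩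
    fromℕ n + fromℕ (m N.* n)          ≈⟨ +-cong (sym (*-identityˡ _)) (fromℕ-* m n) ⟩
    1# * fromℕ n + fromℕ m * fromℕ n   ≈⟨ distribʳ _ _ _ ⟨
    (1# + fromℕ m) * fromℕ n           ∎

  sumTo-cong< : ∀ n {f h : ℕ → Carrier} → (∀ k → k N.< n → f k ≈ h k) → sumTo n f ≈ sumTo n h
  sumTo-cong< zero    f≈h = refl
  sumTo-cong< (suc n) f≈h =
    +-cong (sumTo-cong< n (λ k k<n → f≈h k (N.m<n⇒m<1+n k<n))) (f≈h n (N.n<1+n n))

  sumTo-cong : ∀ n {f h : ℕ → Carrier} → (∀ k → f k ≈ h k) → sumTo n f ≈ sumTo n h
  sumTo-cong n f≈h = sumTo-cong< n (λ k _ → f≈h k)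

  sumTo-+ : ∀ n (f h : ℕ → Carrier) → sumTo n (λ k → f k + h k) ≈ sumTo n f + sumTo n h
  sumTo-+ zero    f h = sym (+-identityˡ _)
  sumTo-+ (suc n) f h = trans (+-congʳ (sumTo-+ n f h))
    (solve 4 (λ a b x y → (a :+ b) :+ (x :+ y) := (a :+ x) :+ (b :+ y)) refl _ _ _ _)

  sumTo-suc : ∀ n (f : ℕ → Carrier) → sumTo (suc n) f ≈ f 0 + sumTo n (λ k → f (suc k))
  sumTo-suc zero    f = trans (+-identityˡ _) (sym (+-identityʳ _))
  sumTo-suc (suc n) f = trans (+-congʳ (sumTo-suc n f)) (+-assoc _ _ _)

  *-sumTo : ∀ n x (f : ℕ → Carrier) → x * sumTo n f ≈ sumTo n (λ k → x * f k)
  *-sumTo zero    x f = zeroʳ x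
  *-sumTo (suc n) x f = trans (distribˡ _ _ _) (+-congʳ (*-sumTo n x f))

  Seq : Set c
  Seq = ℕ → Carrier

  infix  4 _≋_
  infixl 6 _⊕_
  infixr 7 _·_ _⊛_

  _≋_ : Seq → Seq → Set ℓ
  a ≋ b = ∀ k → a k ≈ b k

  shift : Seq → Seq
  shift a k = a (suc k)

  _⊕_ : Seq → Seq → Seq
  (a ⊕ b) k = a k + b k

  _·_ : Carrier → Seq → Seq
  (x · a) k = x * a k

  ε : Seq
  ε zero    = 1#
  ε (suc k) = 0#

  -- Binomial convolution, defined through the Leibniz rule for the derivative
  -- shift; ⊛-binomial recovers the usual binomial sum.
  _⊛_ : Seq → Seq → Seq
  (a ⊛ b) zero    = a 0 * b 0
  (a ⊛ b) (suc n) = (shift a ⊛ b) n + (a ⊛ shift b) n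

  ⊛-cong : ∀ {a a′ b b′} → a ≋ a′ → b ≋ b′ → a ⊛ b ≋ a′ ⊛ b′
  ⊛-cong a≋a′ b≋b′ zero    = *-cong (a≋a′ 0) (b≋b′ 0)
  ⊛-cong a≋a′ b≋b′ (suc n) =
    +-cong (⊛-cong (λ k → a≋a′ (suc k)) b≋b′ n) (⊛-cong a≋a′ (λ k → b≋b′ (suc k)) n)

  ⊛-comm : ∀ a b → a ⊛ b ≋ b ⊛ a
  ⊛-comm a b zero    = *-comm _ _
  ⊛-comm a b (suc n) = trans (+-cong (⊛-comm (shift a) b n) (⊛-comm a (shift b) n)) (+-comm _ _)

  ⊛-distribʳ-⊕ : ∀ a a′ b → (a ⊕ a′) ⊛ b ≋ a ⊛ b ⊕ a′ ⊛ b
  ⊛-distribʳ-⊕ a a′ b zero    = distribʳ _ _ _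
  ⊛-distribʳ-⊕ a a′ b (suc n) =
    trans (+-cong (⊛-distribʳ-⊕ (shift a) (shift a′) b n) (⊛-distribʳ-⊕ a a′ (shift b) n))
          (solve 4 (λ x y z w → (x :+ y) :+ (z :+ w) := (x :+ z) :+ (y :+ w)) refl _ _ _ _)

  ⊛-distribˡ-⊕ : ∀ a b b′ → a ⊛ (b ⊕ b′) ≋ a ⊛ b ⊕ a ⊛ b′
  ⊛-distribˡ-⊕ a b b′ n = begin
    (a ⊛ (b ⊕ b′)) n          ≈⟨ ⊛-comm a _ n ⟩
    ((b ⊕ b′) ⊛ a) n          ≈⟨ ⊛-distribʳ-⊕ b b′ a n ⟩
    (b ⊛ a) n + (b′ ⊛ a) n    ≈⟨ +-cong (⊛-comm b a n) (⊛-comm b′ a n) ⟩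
    (a ⊛ b) n + (a ⊛ b′) n    ∎

  ·-⊛ : ∀ x a b → (x · a) ⊛ b ≋ x · (a ⊛ b)
  ·-⊛ x a b zero    = *-assoc _ _ _
  ·-⊛ x a b (suc n) = trans (+-cong (·-⊛ x (shift a) b n) (·-⊛ x a (shift b) n)) (sym (distribˡ _ _ _))

  ⊛-· : ∀ x a b → a ⊛ (x · b) ≋ x · (a ⊛ b)
  ⊛-· x a b n = trans (⊛-comm a _ n) (trans (·-⊛ x b a n) (*-congˡ (⊛-comm b a n)))

  ⊛-zeroʳ : ∀ a → a ⊛ (λ _ → 0#) ≋ (λ _ → 0#)
  ⊛-zeroʳ a zero    = zeroʳ _
  ⊛-zeroʳ a (suc n) = trans (+-cong (⊛-zeroʳ (shift a) n) (⊛-zeroʳ a n)) (+-identityˡ _)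

  ⊛-sumTo : ∀ m a (f : ℕ → Seq) →
    a ⊛ (λ k → sumTo m (λ l → f l k)) ≋ (λ k → sumTo m (λ l → (a ⊛ f l) k))
  ⊛-sumTo zero    a f = ⊛-zeroʳ a
  ⊛-sumTo (suc m) a f n = trans (⊛-distribˡ-⊕ a _ (f m) n) (+-congʳ (⊛-sumTo m a f n))

  ⊛-assoc : ∀ a b c → (a ⊛ b) ⊛ c ≋ a ⊛ (b ⊛ c)
  ⊛-assoc a b c zero    = *-assoc _ _ _
  ⊛-assoc a b c (suc n) = begin
    (shift (a ⊛ b) ⊛ c) n + ((a ⊛ b) ⊛ shift c) n
      ≈⟨ +-congʳ (⊛-distribʳ-⊕ (shift a ⊛ b) (a ⊛ shift b) c n) ⟩
    ((shift a ⊛ b) ⊛ c) n + ((a ⊛ shift b) ⊛ c) n + ((a ⊛ b) ⊛ shift c) n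
      ≈⟨ +-cong (+-cong (⊛-assoc (shift a) b c n) (⊛-assoc a (shift b) c n)) (⊛-assoc a b (shift c) n) ⟩
    (shift a ⊛ (b ⊛ c)) n + (a ⊛ (shift b ⊛ c)) n + (a ⊛ (b ⊛ shift c)) n
      ≈⟨ +-assoc _ _ _ ⟩
    (shift a ⊛ (b ⊛ c)) n + ((a ⊛ (shift b ⊛ c)) n + (a ⊛ (b ⊛ shift c)) n)
      ≈⟨ +-congˡ (⊛-distribˡ-⊕ a (shift b ⊛ c) (b ⊛ shift c) n) ⟨
    (shift a ⊛ (b ⊛ c)) n + (a ⊛ shift (b ⊛ c)) n ∎

  ε-⊛ : ∀ b → ε ⊛ b ≋ b
  ε-⊛ b zero    = *-identityˡ _
  ε-⊛ b (suc n) = trans (+-congʳ (⊛-comm (shift ε) b n))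
    (trans (+-cong (⊛-zeroʳ b n) (ε-⊛ (shift b) n)) (+-identityˡ _))

  binomialSum : ℕ → Seq → Seq → Carrier
  binomialSum n a b = sumTo (suc n) (λ k → fromℕ (n C k) * a k * b (n N.∸ k))

  binomialSum-pascal : ∀ n a b → binomialSum (suc n) a b ≈ binomialSum n (shift a) b + binomialSum n a (shift b)
  binomialSum-pascal n a b = begin
    sumTo (suc (suc n)) T                         ≈⟨ sumTo-suc (suc n) T ⟩
    T 0 + sumTo (suc n) (shift T)                 ≈⟨ +-congˡ (sumTo-cong (suc n) pascal) ⟩
    T 0 + sumTo (suc n) (λ j → P j + Q j)         ≈⟨ +-congˡ (sumTo-+ (suc n) P Q) ⟩
    T 0 + (sumTo (suc n) P + (sumTo n Q + Q n))   ≈⟨ +-congˡ (+-congˡ (+-congˡ Qn≈0)) ⟩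
    T 0 + (sumTo (suc n) P + (sumTo n Q + 0#))    ≈⟨ +-congˡ (+-congˡ (+-identityʳ _)) ⟩
    T 0 + (sumTo (suc n) P + sumTo n Q)           ≈⟨ +-congˡ (+-congˡ (sumTo-cong< n Q≈shiftU)) ⟩
    T 0 + (sumTo (suc n) P + sumTo n (shift U))
      ≈⟨ solve 3 (λ x y z → x :+ (y :+ z) := y :+ (x :+ z)) refl _ _ _ ⟩
    sumTo (suc n) P + (U 0 + sumTo n (shift U))   ≈⟨ +-congˡ (sumTo-suc n U) ⟨
    sumTo (suc n) P + sumTo (suc n) U             ∎
    where
    T P Q U : Seq
    T k = fromℕ (suc n C k) * a k * b (suc n N.∸ k)
    P j = fromℕ (n C j) * a (suc j) * b (n N.∸ j)
    Q j = fromℕ (n C suc j) * a (suc j) * b (n N.∸ j)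
    U k = fromℕ (n C k) * a k * b (suc (n N.∸ k))
    pascal : shift T ≋ (λ j → P j + Q j)
    pascal j = begin
      fromℕ (suc n C suc j) * a (suc j) * b (n N.∸ j)
        ≡⟨ P.cong (λ k → fromℕ k * a (suc j) * b (n N.∸ j)) (nCk+nC[k+1]≡[n+1]C[k+1] n j) ⟨
      fromℕ (n C j N.+ n C suc j) * a (suc j) * b (n N.∸ j)
        ≈⟨ *-congʳ (*-congʳ (fromℕ-+ (n C j) (n C suc j))) ⟩
      (fromℕ (n C j) + fromℕ (n C suc j)) * a (suc j) * b (n N.∸ j)
        ≈⟨ solve 4 (λ x y z w → (x :+ y) :* z :* w := x :* z :* w :+ y :* z :* w) refl _ _ _ _ ⟩
      P j + Q j ∎
    Qn≈0 : Q n ≈ 0#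
    Qn≈0 = begin
      fromℕ (n C suc n) * a (suc n) * b (n N.∸ n)
        ≡⟨ P.cong (λ k → fromℕ k * a (suc n) * b (n N.∸ n)) (k>n⇒nCk≡0 (N.n<1+n n)) ⟩
      0# * a (suc n) * b (n N.∸ n)                 ≈⟨ *-congʳ (zeroˡ _) ⟩
      0# * b (n N.∸ n)                             ≈⟨ zeroˡ _ ⟩
      0#                                           ∎
    Q≈shiftU : ∀ j → j N.< n → Q j ≈ U (suc j)
    Q≈shiftU j j<n = *-congˡ (reflexive (P.cong b (N.+-∸-assoc 1 j<n)))

  ⊛-binomial : ∀ a b n → (a ⊛ b) n ≈ binomialSum n a b
  ⊛-binomial a b zero = begin
    a 0 * b 0                  ≈⟨ *-identityˡ _ ⟨
    1# * (a 0 * b 0)           ≈⟨ *-assoc _ _ _ ⟨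
    1# * a 0 * b 0             ≈⟨ *-congʳ (*-congʳ (+-identityʳ _)) ⟨
    fromℕ 1 * a 0 * b 0        ≈⟨ +-identityˡ _ ⟨
    0# + fromℕ 1 * a 0 * b 0   ∎
  ⊛-binomial a b (suc n) =
    trans (+-cong (⊛-binomial (shift a) b n) (⊛-binomial a (shift b) n)) (sym (binomialSum-pascal n a b))

  falling : Carrier → Carrier → Seq
  falling lam x k = ff x k lam

  ff-cong : ∀ k lam {x y} → x ≈ y → ff x k lam ≈ ff y k lam
  ff-cong zero    lam x≈y = refl
  ff-cong (suc k) lam x≈y = *-cong (ff-cong k lam x≈y) (+-congʳ x≈y)

  ff-suc : ∀ k lam x → ff x (suc k) lam ≈ x * ff (x - lam) k lam
  ff-suc zero    lam x = solve 3 (λ o x l → o :* (x :- con (+ 0) :* l) := x :* o) refl 1# x lam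
  ff-suc (suc k) lam x = begin
    ff x (suc k) lam * (x - (1# + fromℕ k) * lam)
      ≈⟨ *-cong (ff-suc k lam x) (+-congˡ (-‿cong (trans (distribʳ _ _ _) (+-congʳ (*-identityˡ _))))) ⟩
    x * ff (x - lam) k lam * (x - (lam + fromℕ k * lam))
      ≈⟨ solve 4 (λ x f K l → x :* f :* (x :- (l :+ K :* l)) := x :* (f :* ((x :- l) :- K :* l))) refl x _ _ lam ⟩
    x * (ff (x - lam) k lam * ((x - lam) - fromℕ k * lam)) ∎

  ff-vandermonde : ∀ lam x y → falling lam x ⊛ falling lam y ≋ falling lam (x + y)
  ff-vandermonde lam x y zero    = *-identityˡ _
  ff-vandermonde lam x y (suc n) = begin
    (shift (falling lam x) ⊛ falling lam y) n + (falling lam x ⊛ shift (falling lam y)) n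
      ≈⟨ +-cong (⊛-cong (λ k → ff-suc k lam x) (λ _ → refl) n)
                (⊛-cong (λ _ → refl) (λ k → ff-suc k lam y) n) ⟩
    ((x · falling lam (x - lam)) ⊛ falling lam y) n + (falling lam x ⊛ (y · falling lam (y - lam))) n
      ≈⟨ +-cong (·-⊛ x _ _ n) (⊛-· y _ _ n) ⟩
    x * (falling lam (x - lam) ⊛ falling lam y) n + y * (falling lam x ⊛ falling lam (y - lam)) n
      ≈⟨ +-cong (*-congˡ (ff-vandermonde lam (x - lam) y n)) (*-congˡ (ff-vandermonde lam x (y - lam) n)) ⟩
    x * ff ((x - lam) + y) n lam + y * ff (x + (y - lam)) n lam
      ≈⟨ +-cong (*-congˡ (ff-cong n lam (solve 3 (λ x y l → (x :- l) :+ y := (x :+ y) :- l) refl x y lam)))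
                (*-congˡ (ff-cong n lam (solve 3 (λ x y l → x :+ (y :- l) := (x :+ y) :- l) refl x y lam))) ⟩
    x * ff ((x + y) - lam) n lam + y * ff ((x + y) - lam) n lam
      ≈⟨ distribʳ _ _ _ ⟨
    (x + y) * ff ((x + y) - lam) n lam
      ≈⟨ ff-suc n lam (x + y) ⟨
    ff (x + y) (suc n) lam ∎

  ff-scale : ∀ n t lam y → t ^ n * ff y n lam ≈ ff (t * y) n (t * lam)
  ff-scale zero    t lam y = *-identityˡ _
  ff-scale (suc n) t lam y = begin
    t * t ^ n * (ff y n lam * (y - fromℕ n * lam))
      ≈⟨ solve 6 (λ t p f y K l → t :* p :* (f :* (y :- K :* l)) := p :* f :* (t :* y :- K :* (t :* l)))
                 refl _ _ _ _ _ _ ⟩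
    t ^ n * ff y n lam * (t * y - fromℕ n * (t * lam))
      ≈⟨ *-congʳ (ff-scale n t lam y) ⟩
    ff (t * y) n (t * lam) * (t * y - fromℕ n * (t * lam)) ∎

  lookup-gs : ∀ lam n (i : Fin (suc n)) → lookup (gs lam n) i ≡ g lam (n N.∸ toℕ i)
  lookup-gs lam zero    Fin.zero    = P.refl
  lookup-gs lam (suc n) Fin.zero    = P.refl
  lookup-gs lam (suc n) (Fin.suc i) = lookup-gs lam n i

  sumV-tabulate : ∀ n (f : Fin n → Carrier) (h : ℕ → Carrier) → (∀ i → f i ≈ h (toℕ i)) →
    sumV (tabulate f) ≈ sumTo n h
  sumV-tabulate zero    f h f≈h = refl
  sumV-tabulate (suc n) f h f≈h =
    trans (+-cong (f≈h Fin.zero) (sumV-tabulate n (λ i → f (Fin.suc i)) (shift h) (λ i → f≈h (Fin.suc i))))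
          (sym (sumTo-suc n h))

  g-suc : ∀ lam n → g lam (suc n) ≈
    - (half * sumTo (suc n) (λ j → fromℕ (suc n C suc j) * aCoef lam (suc j) * g lam (n N.∸ j)))
  g-suc lam n = -‿cong (*-congˡ (sumV-tabulate (suc n) _ _ λ i →
    reflexive (P.cong (fromℕ (suc n C suc (toℕ i)) * aCoef lam (suc (toℕ i)) *_) (lookup-gs lam n i))))

  alternating-telescope : ∀ (f : ℕ → Carrier) m →
    sumTo m (λ l → sign l * (f (suc l) + f l)) ≈ f 0 - sign m * f m
  alternating-telescope f zero    = sym (trans (+-congˡ (-‿cong (*-identityˡ _))) (-‿inverseʳ _))
  alternating-telescope f (suc m) = trans (+-congʳ (alternating-telescope f m))
    (solve 4 (λ a s b c → (a :- s :* b) :+ s :* (c :+ b) := a :- (:- s) :* c) refl (f 0) (sign m) (f m) (f (suc m)))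

  sign-odd : ∀ m → m N.% 2 ≡ 1 → sign m ≈ - 1#
  sign-odd m m%2≡1 = trans (reflexive (P.cong sign m≡1+[m/2]*2)) (sign-1+2q (m N./ 2))
    where
    m≡1+[m/2]*2 : m ≡ suc (m N./ 2 N.* 2)
    m≡1+[m/2]*2 = P.trans (N.m≡m%n+[m/n]*n m 2) (P.cong (N._+ (m N./ 2 N.* 2)) m%2≡1)
    sign-1+2q : ∀ q → sign (suc (q N.* 2)) ≈ - 1#
    sign-1+2q zero    = refl
    sign-1+2q (suc q) = trans (⁻¹-involutive _) (sign-1+2q q)

  alternatingSum : Carrier → ℕ → Seq
  alternatingSum lam m k = sumTo m (λ l → sign l * ff (fromℕ l + half) k lam)

  module _ (two*half≈1 : two * half ≈ 1#) where

    g⊛aCoef : ∀ lam → g lam ⊛ aCoef lam ≋ two · ε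
    g⊛aCoef lam zero    = trans (*-identityˡ _) (sym (*-identityʳ _))
    g⊛aCoef lam (suc n) = begin
      (g lam ⊛ aCoef lam) (suc n)          ≈⟨ ⊛-comm (g lam) (aCoef lam) (suc n) ⟩
      (aCoef lam ⊛ g lam) (suc n)          ≈⟨ ⊛-binomial (aCoef lam) (g lam) (suc n) ⟩
      binomialSum (suc n) (aCoef lam) (g lam) ≈⟨ sumTo-suc (suc n) _ ⟩
      fromℕ 1 * two * g lam (suc n) + X    ≈⟨ +-congʳ (*-congʳ (trans (*-congʳ (+-identityʳ _)) (*-identityˡ _))) ⟩
      two * g lam (suc n) + X              ≈⟨ +-congʳ (*-congˡ (g-suc lam n)) ⟩
      two * - (half * X) + X
        ≈⟨ solve 3 (λ t h x → t :* (:- (h :* x)) :+ x := (x :- (t :* h) :* x)) refl two half X ⟩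
      X - two * half * X                   ≈⟨ +-congˡ (-‿cong (trans (*-congʳ two*half≈1) (*-identityˡ X))) ⟩
      X - X                                ≈⟨ -‿inverseʳ X ⟩
      0#                                   ≈⟨ zeroʳ two ⟨
      two * 0#                             ∎
      where
      X = sumTo (suc n) (λ j → fromℕ (suc n C suc j) * aCoef lam (suc j) * g lam (n N.∸ j))

    half+half≈1 : half + half ≈ 1#
    half+half≈1 = begin
      half + half               ≈⟨ +-cong (*-identityˡ half) (*-identityˡ half) ⟨
      1# * half + 1# * half     ≈⟨ distribʳ half 1# 1# ⟨
      two * half                ≈⟨ two*half≈1 ⟩
      1#                        ∎

    aCoef⊛falling : ∀ lam x → aCoef lam ⊛ falling lam (x + half) ≋ falling lam (1# + x) ⊕ falling lam x
    aCoef⊛falling lam x k = begin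
      ((falling lam half ⊕ falling lam (- half)) ⊛ falling lam (x + half)) k
        ≈⟨ ⊛-distribʳ-⊕ _ _ _ k ⟩
      (falling lam half ⊛ falling lam (x + half)) k + (falling lam (- half) ⊛ falling lam (x + half)) k
        ≈⟨ +-cong (ff-vandermonde lam _ _ k) (ff-vandermonde lam _ _ k) ⟩
      ff (half + (x + half)) k lam + ff (- half + (x + half)) k lam
        ≈⟨ +-cong (ff-cong k lam half+[x+half]≈1+x)
                  (ff-cong k lam (solve 2 (λ h x → (:- h) :+ (x :+ h) := x) refl half x)) ⟩
      ff (1# + x) k lam + ff x k lam ∎
      where
      half+[x+half]≈1+x : half + (x + half) ≈ 1# + x
      half+[x+half]≈1+x = begin
        half + (x + half)       ≈⟨ solve 2 (λ h x → h :+ (x :+ h) := (h :+ h) :+ x) refl half x ⟩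
        (half + half) + x       ≈⟨ +-congʳ half+half≈1 ⟩
        1# + x                  ∎

    aCoef⊛alternatingSum : ∀ lam m → m N.% 2 ≡ 1 →
      aCoef lam ⊛ alternatingSum lam m ≋ falling lam (fromℕ m) ⊕ falling lam 0#
    aCoef⊛alternatingSum lam m m-odd k = begin
      (aCoef lam ⊛ alternatingSum lam m) k
        ≈⟨ ⊛-sumTo m (aCoef lam) (λ l → sign l · falling lam (fromℕ l + half)) k ⟩
      sumTo m (λ l → (aCoef lam ⊛ (sign l · falling lam (fromℕ l + half))) k)
        ≈⟨ sumTo-cong m (λ l → trans (⊛-· (sign l) _ _ k) (*-congˡ (aCoef⊛falling lam (fromℕ l) k))) ⟩
      sumTo m (λ l → sign l * (ff (fromℕ (suc l)) k lam + ff (fromℕ l) k lam))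
        ≈⟨ alternating-telescope (λ l → ff (fromℕ l) k lam) m ⟩
      ff 0# k lam - sign m * ff (fromℕ m) k lam
        ≈⟨ +-congˡ (-‿cong (*-congʳ (sign-odd m m-odd))) ⟩
      ff 0# k lam - - 1# * ff (fromℕ m) k lam
        ≈⟨ solve 3 (λ o a b → a :- (:- o) :* b := o :* b :+ a) refl 1# _ _ ⟩
      1# * ff (fromℕ m) k lam + ff 0# k lam
        ≈⟨ +-congʳ (*-identityˡ _) ⟩
      ff (fromℕ m) k lam + ff 0# k lam ∎

    E-sum : ∀ lam n m → m N.% 2 ≡ 1 → E n lam (fromℕ m) + E n lam 0# ≈ two * alternatingSum lam m n
    E-sum lam n m m-odd = begin
      E n lam (fromℕ m) + E n lam 0#
        ≈⟨ +-cong (⊛-binomial G (falling lam (fromℕ m)) n) (⊛-binomial G (falling lam 0#) n) ⟨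
      (G ⊛ falling lam (fromℕ m)) n + (G ⊛ falling lam 0#) n
        ≈⟨ ⊛-distribˡ-⊕ G _ _ n ⟨
      (G ⊛ (falling lam (fromℕ m) ⊕ falling lam 0#)) n
        ≈⟨ ⊛-cong (λ _ → refl) (aCoef⊛alternatingSum lam m m-odd) n ⟨
      (G ⊛ (aCoef lam ⊛ S)) n              ≈⟨ ⊛-assoc G (aCoef lam) S n ⟨
      ((G ⊛ aCoef lam) ⊛ S) n              ≈⟨ ⊛-cong (g⊛aCoef lam) (λ _ → refl) n ⟩
      ((two · ε) ⊛ S) n                    ≈⟨ ·-⊛ two ε S n ⟩
      two * (ε ⊛ S) n                      ≈⟨ *-congˡ (ε-⊛ S n) ⟩
      two * S n                            ∎
      where
      G = g lam
      S = alternatingSum lam m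

    pow2m1-*-two : ∀ n → pow2m1 n * two ≈ two ^ n
    pow2m1-*-two zero          = trans (*-comm _ _) two*half≈1
    pow2m1-*-two (suc zero)    = *-comm _ _
    pow2m1-*-two (suc (suc n)) = trans (*-assoc _ _ _) (*-congˡ (pow2m1-*-two (suc n)))

    two*[l+half] : ∀ l → two * (fromℕ l + half) ≈ fromℕ (2 N.* l N.+ 1)
    two*[l+half] l = sym (begin
      fromℕ (2 N.* l N.+ 1)             ≈⟨ fromℕ-+ (2 N.* l) 1 ⟩
      fromℕ (2 N.* l) + fromℕ 1         ≈⟨ +-cong (fromℕ-* 2 l) (+-identityʳ 1#) ⟩
      fromℕ 2 * fromℕ l + 1#            ≈⟨ +-cong (*-congʳ (+-congˡ (+-identityʳ 1#))) (sym two*half≈1) ⟩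
      two * fromℕ l + two * half        ≈⟨ distribˡ _ _ _ ⟨
      two * (fromℕ l + half)            ∎)

    two^n*alternatingSum : ∀ lam m n →
      two ^ n * alternatingSum lam m n ≈ sumTo m (λ l → sign l * ff (fromℕ (2 N.* l N.+ 1)) n (two * lam))
    two^n*alternatingSum lam m n = trans (*-sumTo m (two ^ n) _) (sumTo-cong m λ l → begin
      two ^ n * (sign l * ff (fromℕ l + half) n lam)
        ≈⟨ solve 3 (λ x y z → x :* (y :* z) := y :* (x :* z)) refl _ _ _ ⟩
      sign l * (two ^ n * ff (fromℕ l + half) n lam)
        ≈⟨ *-congˡ (ff-scale n two lam _) ⟩
      sign l * ff (two * (fromℕ l + half)) n (two * lam)
        ≈⟨ *-congˡ (ff-cong n (two * lam) (two*[l+half] l)) ⟩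
      sign l * ff (fromℕ (2 N.* l N.+ 1)) n (two * lam) ∎)

theorem2p17 : ∀ {c ℓ} (R : CommutativeRing c ℓ) (half : CommutativeRing.Carrier R) →
    let open Degenerate R half
    in two * half ≈ 1# →
    (lam : Carrier) → ¬ (lam ≈ 0#) →
    (n m : ℕ) → m N.% 2 ≡ 1 →
    pow2m1 n * (E n lam (fromℕ m) + E n lam 0#)
    ≈ sumTo m (λ l → sign l * ff (fromℕ (2 N.* l N.+ 1)) n (two * lam))
theorem2p17 R half two*half≈1 lam _ n m m-odd = begin
  pow2m1 n * (E n lam (fromℕ m) + E n lam 0#)  ≈⟨ *-congˡ (E-sum two*half≈1 lam n m m-odd) ⟩
  pow2m1 n * (two * alternatingSum lam m n)    ≈⟨ *-assoc _ _ _ ⟨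
  pow2m1 n * two * alternatingSum lam m n      ≈⟨ *-congʳ (pow2m1-*-two two*half≈1 n) ⟩
  two ^ n * alternatingSum lam m n             ≈⟨ two^n*alternatingSum two*half≈1 lam m n ⟩
  sumTo m (λ l → sign l * ff (fromℕ (2 N.* l N.+ 1)) n (two * lam)) ∎
  where
  open Degenerate R half
  open Lemmas R half
  open import Algebra.Properties.Semiring.Exp semiring using (_^_)
  open import Relation.Binary.Reasoning.Setoid setoid
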